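{- There exist bipartite graphs $G$ and integers $k$ with $k-1\ge\chi(G)$ for which $\mathrm{sn}(G,k)<\mathrm{sn}(G,k-1)$; that is, $\mathrm{sn}(G,k)$ is not in general monotone non-decreasing in $k$.
   Context: For a graph $G=(V,E)$ and an integer $k\ge\chi(G)$, a proper $k$-colouring is a map $c\colon V\to\{1,\dots,k\}$ with adjacent vertices receiving different colours. $\mathrm{sn}(G,k)$ is the minimum number of vertices coloured in a partial colouring of $G$ that has a unique extension to a proper $k$-colouring of $G$. -}

module Defs where

open import Data.Nat using (ℕ; zero; suc; _+_; _≤_)
open import Data.Fin using (Fin; zero; suc)
open import Data.Bool using (Bool; true; false)
open import Data.Maybe using (Maybe; just; nothing)
open import Data.Product using (Σ; ∃; _×_; _,_)
open import Relation.Binary.PropositionalEquality using (_≡_)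
open import Relation.Nullary using (¬_)

record Graph : Set where
  field
    n     : ℕ
    adj   : Fin n → Fin n → Bool
    sym   : ∀ u v → adj u v ≡ adj v u
    irrefl : ∀ v → adj v v ≡ false

open Graph public

Colouring : Graph → ℕ → Set
Colouring G k = Fin (n G) → Fin k

Proper : (G : Graph) (k : ℕ) → Colouring G k → Set
Proper G k c = ∀ u v → adj G u v ≡ true → ¬ (c u ≡ c v)

Colourable : Graph → ℕ → Set
Colourable G k = Σ (Colouring G k) (Proper G k)

IsMin : (ℕ → Set) → ℕ → Set
IsMin P m = P m × (∀ m' → P m' → m ≤ m')

IsChromaticNumber : Graph → ℕ → Set
IsChromaticNumber G χ = IsMin (Colourable G) χ

Bipartite : Graph → Set
Bipartite G = Colourable G 2

PartialColouring : Graph → ℕ → Set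
PartialColouring G k = Fin (n G) → Maybe (Fin k)

size : ∀ {m k} → (Fin m → Maybe (Fin k)) → ℕ
size {zero}  p = 0
size {suc m} p with p zero
... | just _  = suc (size (λ i → p (suc i)))
... | nothing = size (λ i → p (suc i))

Extends : (G : Graph) (k : ℕ) → PartialColouring G k → Colouring G k → Set
Extends G k p c = ∀ v x → p v ≡ just x → c v ≡ x

UniqueExtension : (G : Graph) (k : ℕ) → PartialColouring G k → Set
UniqueExtension G k p =
  Σ (Colouring G k) (λ c → Proper G k c × Extends G k p c ×
     (∀ c' → Proper G k c' → Extends G k p c' → ∀ v → c' v ≡ c v))

HasDefiningSetOfSize : Graph → ℕ → ℕ → Set
HasDefiningSetOfSize G k m =
  Σ (PartialColouring G k) (λ p → size p ≡ m × UniqueExtension G k p)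

IsSn : Graph → ℕ → ℕ → Set
IsSn G k s = IsMin (HasDefiningSetOfSize G k) s

{-# OPTIONS --safe #-}
-- G has hubs u₀,…,u₄ and, for each block j, five leaves adjacent to every hub uᵢ with i ≠ j:
-- the crown graph (K₅,₅ minus a perfect matching) with every vertex of one side replaced by
-- five twins.
-- Upper bounds: with five colours, colouring uᵢ by i forces every leaf (it sees all colours
-- but its own block's), so sn(G,5) ≤ 5. With four colours, hubs coloured 0,0,1,1,2 force the
-- leaves of blocks 0–3 to colour 3; the leaves of block 4 see only {0,1}, and pinning them gives
-- sn(G,4) ≤ 10.
-- Lower bounds: for a partial colouring with a unique extension, an uncoloured vertex sees
-- every colour but its own among its neighbours. So an uncoloured leaf of block j sees on the
-- hubs outside j all colours but exactly one, and an uncoloured hub uᵢ finds every other colour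
-- on a leaf block l ≠ i. Exhaustive search over the hub colourings shows: with five colours the
-- first condition for every j makes the hubs injective; with four colours it cannot hold for all
-- j, and when it holds for all j but one, no hub is uncoloured. Counting coloured vertices per
-- block finishes both bounds, except for five colours with an empty block next to a block with
-- at most one coloured vertex: there, moving a hub colour onto the other block's leaves gives a
-- second extension.

module Submission where

open import Defs hiding (sym)
open import Data.Nat using (ℕ; zero; suc; _+_; _*_; _≤_; _<_; _∸_; z≤n; s≤s; _≤?_; _<?_)
open import Data.Nat.Properties
  using (n≤0⇒n≡0; ≤-pred; <⇒≱; ≤-refl; ≤-trans; ≤-reflexive; m≤m+n; m≤n+m; n≤1+n; n≮0; ≮⇒≥; ≰⇒>; n≢0⇒n>0;
         +-mono-≤; +-0-commutativeMonoid)
  renaming (_≟_ to _≟ℕ_)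
open import Data.Fin using (Fin; zero; suc; combine; remQuot; _↑ˡ_; _↑ʳ_; punchIn; punchOut)
open import Data.Fin.Patterns using (0F; 1F; 2F; 3F; 4F)
open import Data.Fin.Properties
  using (_≟_; any?; all?; remQuot-combine; combine-remQuot; punchInᵢ≢i; punchIn-punchOut)
open import Data.Bool using (Bool; true; false; not; _∧_; _∨_; if_then_else_)
open import Data.Bool.Properties using (T-≡) renaming (_≟_ to _≟ᵇ_)
open import Data.Maybe using (Maybe; just; nothing)
open import Data.Maybe.Properties using (just-injective) renaming (≡-dec to ≡-decᵐ)
open import Data.Product using (Σ; ∃-syntax; _×_; _,_; proj₁; proj₂; uncurry)
open import Data.Sum using (_⊎_; inj₁; inj₂)
open import Data.Empty using (⊥; ⊥-elim)
open import Data.Vec.Functional using ([]; _∷_; updateAt; removeAt)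
open import Data.Vec.Functional.Properties using (updateAt-updates; updateAt-minimal)
open import Algebra.Properties.CommutativeMonoid.Sum +-0-commutativeMonoid using (sum; sum-remove)
open import Function using (_∘_; id; const; flip; Equivalence)
open import Function.Definitions using (Injective)
open import Relation.Nullary using (¬_; Dec; yes; no; contradiction)
open import Relation.Nullary.Decidable
  using (⌊_⌋; ¬?; _×-dec_; decidable-stable; from-yes; from-no;
         toWitness; fromWitness; fromWitnessFalse; toWitnessFalse)
open import Relation.Binary.PropositionalEquality
  using (_≡_; _≢_; _≗_; refl; sym; trans; cong; cong₂; subst; ≢-sym)

open Equivalence using (to; from)

-- Boolean facts are stated as b ≡ true rather than T b: with T, Agda renormalises the large
-- checked terms at every use.
infix 4 _==_

_==_ : ∀ {m} → Fin m → Fin m → Bool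
i == j = ⌊ i ≟ j ⌋

==-refl : ∀ {m} (i : Fin m) → (i == i) ≡ true
==-refl i = to T-≡ (fromWitness refl)

==-sound : ∀ {m} (i j : Fin m) → (i == j) ≡ true → i ≡ j
==-sound i j h = toWitness (from T-≡ h)

==-complete : ∀ {m} {i j : Fin m} → i ≡ j → (i == j) ≡ true
==-complete refl = ==-refl _

not-==⇒≢ : ∀ {m} {i j : Fin m} → not (i == j) ≡ true → i ≢ j
not-==⇒≢ h = toWitnessFalse (from T-≡ h)

≢⇒not-== : ∀ {m} {i j : Fin m} → i ≢ j → not (i == j) ≡ true
≢⇒not-== i≢j = to T-≡ (fromWitnessFalse i≢j)

not-true : ∀ {b} → not b ≡ true → b ≢ true
not-true {false} _ ()

unless-== : ∀ {m} (i j : Fin m) {b} → (i ≢ j → b ≡ true) → (i == j) ∨ b ≡ true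
unless-== i j h with i ≟ j
... | yes _  = refl
... | no i≢j = h i≢j

implies : ∀ {a b} → not a ∨ b ≡ true → a ≡ true → b ≡ true
implies h refl = h

∧-intro : ∀ {a b} → a ≡ true → b ≡ true → a ∧ b ≡ true
∧-intro refl refl = refl

∧-elim : ∀ {a b} → a ∧ b ≡ true → a ≡ true × b ≡ true
∧-elim {true} h = refl , h

∨-introʳ : ∀ a {b} → b ≡ true → a ∨ b ≡ true
∨-introʳ true  _ = refl
∨-introʳ false h = h

∀ᵇ : ∀ {m} → (Fin m → Bool) → Bool
∀ᵇ {zero}  p = true
∀ᵇ {suc m} p = p zero ∧ ∀ᵇ (p ∘ suc)

∃ᵇ : ∀ {m} → (Fin m → Bool) → Bool
∃ᵇ {zero}  p = false
∃ᵇ {suc m} p = p zero ∨ ∃ᵇ (p ∘ suc)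

∀ᵇ-sound : ∀ {m} (p : Fin m → Bool) → ∀ᵇ p ≡ true → ∀ i → p i ≡ true
∀ᵇ-sound p h zero    = proj₁ (∧-elim {p zero} h)
∀ᵇ-sound p h (suc i) = ∀ᵇ-sound (p ∘ suc) (proj₂ (∧-elim {p zero} h)) i

∀ᵇ-complete : ∀ {m} (p : Fin m → Bool) → (∀ i → p i ≡ true) → ∀ᵇ p ≡ true
∀ᵇ-complete {zero}  p h = refl
∀ᵇ-complete {suc m} p h = ∧-intro (h zero) (∀ᵇ-complete (p ∘ suc) (h ∘ suc))

∃ᵇ-complete : ∀ {m} (p : Fin m → Bool) i → p i ≡ true → ∃ᵇ p ≡ true
∃ᵇ-complete p zero    h rewrite h = refl
∃ᵇ-complete p (suc i) h = ∨-introʳ (p zero) (∃ᵇ-complete (p ∘ suc) i h)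

∀ᶠ : ∀ {m k} → ((Fin m → Fin k) → Bool) → Bool
∀ᶠ {zero}  p = p []
∀ᶠ {suc m} p = ∀ᵇ λ a → ∀ᶠ λ f → p (a ∷ f)

expand : ∀ {m} {A : Set} → (Fin m → A) → Fin m → A
expand {zero}  f = []
expand {suc m} f = f zero ∷ expand (f ∘ suc)

expand-≗ : ∀ {m} {A : Set} (f : Fin m → A) → expand f ≗ f
expand-≗ f zero    = refl
expand-≗ f (suc i) = expand-≗ (f ∘ suc) i

∀ᶠ-sound : ∀ {m k} (p : (Fin m → Fin k) → Bool) → ∀ᶠ p ≡ true → ∀ f → p (expand f) ≡ true
∀ᶠ-sound {zero}  p h f = h
∀ᶠ-sound {suc m} p h f = ∀ᶠ-sound (λ g → p (f zero ∷ g)) (∀ᵇ-sound _ h (f zero)) (f ∘ suc)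

-- Hub colourings

-- f : Fin m → Fin k stands for the colours of the hubs. AllButOne f j is what an uncoloured
-- leaf of block j sees; Forced f i is what an uncoloured hub i sees: each other colour x on a
-- leaf of some block l ≠ i, so that the hubs outside l miss x.
Misses : ∀ {m k} → (Fin m → Fin k) → Fin m → Fin k → Set
Misses f j x = ∀ i → i ≢ j → f i ≢ x

AllButOne : ∀ {m k} → (Fin m → Fin k) → Fin m → Set
AllButOne f j = ∃[ x ] Misses f j x × (∀ a → a ≢ x → ∃[ i ] i ≢ j × f i ≡ a)

Forced : ∀ {m k} → (Fin m → Fin k) → Fin m → Set
Forced f i = ∀ x → x ≢ f i → ∃[ l ] l ≢ i × Misses f l x

module _ {m k : ℕ} {f g : Fin m → Fin k} (f≗g : f ≗ g) where

  Misses-resp : ∀ {j x} → Misses f j x → Misses g j x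
  Misses-resp misses i i≢j = misses i i≢j ∘ trans (f≗g i)

  AllButOne-resp : ∀ {j} → AllButOne f j → AllButOne g j
  AllButOne-resp (x , misses , covers) = x , Misses-resp misses , λ a a≢x →
    let (i , i≢j , fi≡a) = covers a a≢x in i , i≢j , trans (sym (f≗g i)) fi≡a

  Forced-resp : ∀ {i} → Forced f i → Forced g i
  Forced-resp {i} forced x x≢gi =
    let (l , l≢i , misses) = forced x (x≢gi ∘ flip trans (f≗g i)) in l , l≢i , Misses-resp misses

  Injective-resp : Injective _≡_ _≡_ f → Injective _≡_ _≡_ g
  Injective-resp f-inj {i} {j} gi≡gj = f-inj (trans (f≗g i) (trans gi≡gj (sym (f≗g j))))

missesᵇ : ∀ {m k} → (Fin m → Fin k) → Fin m → Fin k → Bool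
missesᵇ f j x = ∀ᵇ λ i → (i == j) ∨ not (f i == x)

allButOneᵇ : ∀ {m k} → (Fin m → Fin k) → Fin m → Bool
allButOneᵇ f j = ∃ᵇ λ x → missesᵇ f j x ∧ ∀ᵇ λ a → (a == x) ∨ ∃ᵇ λ i → not (i == j) ∧ (f i == a)

forcedᵇ : ∀ {m k} → (Fin m → Fin k) → Fin m → Bool
forcedᵇ f i = ∀ᵇ λ x → (x == f i) ∨ ∃ᵇ λ l → not (l == i) ∧ missesᵇ f l x

injectiveᵇ : ∀ {m k} → (Fin m → Fin k) → Bool
injectiveᵇ f = ∀ᵇ λ i → ∀ᵇ λ j → not (f i == f j) ∨ (i == j)

misses⇒missesᵇ : ∀ {m k} (f : Fin m → Fin k) j x → Misses f j x → missesᵇ f j x ≡ true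
misses⇒missesᵇ f j x h = ∀ᵇ-complete _ λ i → unless-== i j λ i≢j → ≢⇒not-== (h i i≢j)

allButOne⇒allButOneᵇ : ∀ {m k} (f : Fin m → Fin k) j → AllButOne f j → allButOneᵇ f j ≡ true
allButOne⇒allButOneᵇ f j (x , misses , covers) =
  ∃ᵇ-complete _ x (∧-intro (misses⇒missesᵇ f j x misses) (∀ᵇ-complete _ λ a → unless-== a x λ a≢x →
    let (i , i≢j , fi≡a) = covers a a≢x
    in ∃ᵇ-complete _ i (∧-intro (≢⇒not-== i≢j) (==-complete fi≡a))))

forced⇒forcedᵇ : ∀ {m k} (f : Fin m → Fin k) i → Forced f i → forcedᵇ f i ≡ true
forced⇒forcedᵇ f i h = ∀ᵇ-complete _ λ x → unless-== x (f i) λ x≢fi →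
  let (l , l≢i , misses) = h x x≢fi
  in ∃ᵇ-complete _ l (∧-intro (≢⇒not-== l≢i) (misses⇒missesᵇ f l x misses))

injectiveᵇ-sound : ∀ {m k} (f : Fin m → Fin k) → injectiveᵇ f ≡ true → Injective _≡_ _≡_ f
injectiveᵇ-sound f h {i} {j} fi≡fj =
  ==-sound i j (implies (∀ᵇ-sound (λ j → not (f i == f j) ∨ (i == j)) (∀ᵇ-sound _ h i) j)
                        (==-complete fi≡fj))

injectivityCheck : (Fin 5 → Fin 5) → Bool
injectivityCheck f = not (∀ᵇ (allButOneᵇ f)) ∨ injectiveᵇ f

injectivityCheck-holds : ∀ᶠ injectivityCheck ≡ true
injectivityCheck-holds = refl

allButOne-everywhere⇒injective : (f : Fin 5 → Fin 5) → (∀ j → AllButOne f j) → Injective _≡_ _≡_ f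
allButOne-everywhere⇒injective f h = Injective-resp (expand-≗ f) (injectiveᵇ-sound f′
  (implies (∀ᶠ-sound injectivityCheck injectivityCheck-holds f)
           (∀ᵇ-complete (allButOneᵇ f′) λ j →
              allButOne⇒allButOneᵇ f′ j (AllButOne-resp (sym ∘ expand-≗ f) (h j)))))
  where
  f′ : Fin 5 → Fin 5
  f′ = expand f

noAllButOneCheck : (Fin 5 → Fin 4) → Bool
noAllButOneCheck f = not (∀ᵇ (allButOneᵇ f))

noAllButOneCheck-holds : ∀ᶠ noAllButOneCheck ≡ true
noAllButOneCheck-holds = refl

¬allButOne-everywhere : (f : Fin 5 → Fin 4) → ¬ (∀ j → AllButOne f j)
¬allButOne-everywhere f h =
  not-true (∀ᶠ-sound noAllButOneCheck noAllButOneCheck-holds f)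
    (∀ᵇ-complete (allButOneᵇ f′) λ j → allButOne⇒allButOneᵇ f′ j (AllButOne-resp (sym ∘ expand-≗ f) (h j)))
  where
  f′ : Fin 5 → Fin 4
  f′ = expand f

allButOneOffᵇ : (Fin 5 → Fin 4) → Fin 5 → Bool
allButOneOffᵇ f j = ∀ᵇ λ l → (l == j) ∨ allButOneᵇ f l

unforcedCheck : (Fin 5 → Fin 4) → Bool
unforcedCheck f = ∀ᵇ λ j → not (allButOneOffᵇ f j) ∨ ∀ᵇ (not ∘ forcedᵇ f)

unforcedCheck-holds : ∀ᶠ unforcedCheck ≡ true
unforcedCheck-holds = refl

allButOne-off⇒¬forced : (f : Fin 5 → Fin 4) (j : Fin 5) → (∀ l → l ≢ j → AllButOne f l) →
                        ∀ i → ¬ Forced f i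
allButOne-off⇒¬forced f j h i forced =
  not-true (∀ᵇ-sound (not ∘ forcedᵇ f′) unforced i)
           (forced⇒forcedᵇ f′ i (Forced-resp (sym ∘ expand-≗ f) forced))
  where
  f′ : Fin 5 → Fin 4
  f′ = expand f

  unforced : ∀ᵇ (not ∘ forcedᵇ f′) ≡ true
  unforced = implies
    (∀ᵇ-sound (λ j → not (allButOneOffᵇ f′ j) ∨ ∀ᵇ (not ∘ forcedᵇ f′))
              (∀ᶠ-sound unforcedCheck unforcedCheck-holds f) j)
    (∀ᵇ-complete (λ l → (l == j) ∨ allButOneᵇ f′ l) λ l →
      unless-== l j (allButOne⇒allButOneᵇ f′ l ∘ AllButOne-resp (sym ∘ expand-≗ f) ∘ h l))

size-++ : ∀ a b {k} (q : Fin (a + b) → Maybe (Fin k)) →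
          size q ≡ size (q ∘ (_↑ˡ b)) + size (q ∘ (a ↑ʳ_))
size-++ zero    b q = refl
size-++ (suc a) b q with q zero
... | just _  = cong suc (size-++ a b (q ∘ suc))
... | nothing = size-++ a b (q ∘ suc)

size-combine : ∀ r {b k} (q : Fin (r * b) → Maybe (Fin k)) →
               size q ≡ sum {r} (λ i → size (q ∘ combine {r} {b} i))
size-combine zero    q = refl
size-combine (suc r) {b} q =
  trans (size-++ b (r * b) q) (cong (size (q ∘ (_↑ˡ (r * b))) +_) (size-combine r (q ∘ (b ↑ʳ_))))

size-complete : ∀ {m k} (q : Fin m → Maybe (Fin k)) → (∀ i → q i ≢ nothing) → size q ≡ m
size-complete {zero}  q coloured = refl
size-complete {suc m} q coloured with q zero | coloured zero
... | just _  | _ = cong suc (size-complete (q ∘ suc) (coloured ∘ suc))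
... | nothing | c0 = contradiction refl c0

size-pos : ∀ {m k} (q : Fin m → Maybe (Fin k)) i → q i ≢ nothing → 1 ≤ size q
size-pos q zero    coloured with q zero
... | just _  = s≤s z≤n
... | nothing = contradiction refl coloured
size-pos q (suc i) coloured with q zero
... | just _  = s≤s z≤n
... | nothing = size-pos (q ∘ suc) i coloured

size≡0⇒uncoloured : ∀ {m k} (q : Fin m → Maybe (Fin k)) → size q ≡ 0 → ∀ i → q i ≡ nothing
size≡0⇒uncoloured q empty i = decidable-stable (≡-decᵐ _≟_ (q i) nothing) λ coloured →
  n≮0 (subst (1 ≤_) empty (size-pos q i coloured))

size-tail≤size : ∀ {m k} (q : Fin (suc m) → Maybe (Fin k)) → size (q ∘ suc) ≤ size q
size-tail≤size q with q zero
... | just _  = n≤1+n _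
... | nothing = ≤-refl

tail-coloured⇒≤size : ∀ {m k} (q : Fin (suc m) → Maybe (Fin k)) →
                      (∀ s → q (suc s) ≢ nothing) → m ≤ size q
tail-coloured⇒≤size q coloured =
  ≤-trans (≤-reflexive (sym (size-complete (q ∘ suc) coloured))) (size-tail≤size q)

size<-tail-uncoloured : ∀ {m k} (q : Fin (suc m) → Maybe (Fin k)) →
                        size q < m → ∃[ s ] q (suc s) ≡ nothing
size<-tail-uncoloured q small with any? (λ s → ≡-decᵐ _≟_ (q (suc s)) nothing)
... | yes free = free
... | no none  = contradiction (tail-coloured⇒≤size q λ s e → none (s , e)) (<⇒≱ small)

size-head : ∀ {m k} (q : Fin (suc m) → Maybe (Fin k)) →
            q zero ≢ nothing → size q ≡ suc (size (q ∘ suc))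
size-head q coloured with q zero
... | just _  = refl
... | nothing = contradiction refl coloured

size≤1⇒head-or-tail-uncoloured : ∀ {m k} (q : Fin (suc m) → Maybe (Fin k)) → size q ≤ 1 →
                                 q zero ≡ nothing ⊎ (∀ s → q (suc s) ≡ nothing)
size≤1⇒head-or-tail-uncoloured q tiny with ≡-decᵐ _≟_ (q zero) nothing
... | yes free    = inj₁ free
... | no coloured =
  inj₂ (size≡0⇒uncoloured (q ∘ suc) (n≤0⇒n≡0 (≤-pred (subst (_≤ 1) (size-head q coloured) tiny))))

≤-sum : ∀ {m} (B : Fin m → ℕ) i → B i ≤ sum B
≤-sum {suc m} B i = subst (B i ≤_) (sym (sum-remove {i = i} B)) (m≤m+n (B i) _)

*-≤-sum : ∀ {m} (B : Fin m → ℕ) t → (∀ i → t ≤ B i) → m * t ≤ sum B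
*-≤-sum {zero}  B t _ = z≤n
*-≤-sum {suc m} B t h = +-mono-≤ (h zero) (*-≤-sum (B ∘ suc) t (h ∘ suc))

+-≤-sum : ∀ {m} (B : Fin (suc m) → ℕ) {i j} → i ≢ j → B i + B j ≤ sum B
+-≤-sum B {i} {j} i≢j = subst (B i + B j ≤_) (sym (sum-remove {i = i} B)) (+-mono-≤ (≤-refl {B i})
  (subst (_≤ sum (removeAt B i)) (cong B (punchIn-punchOut i≢j))
         (≤-sum (removeAt B i) (punchOut i≢j))))

+*-≤-sum : ∀ {m} (B : Fin (suc m) → ℕ) i t → (∀ j → j ≢ i → t ≤ B j) → B i + m * t ≤ sum B
+*-≤-sum {m} B i t h = subst (B i + m * t ≤_) (sym (sum-remove {i = i} B))
  (+-mono-≤ (≤-refl {B i}) (*-≤-sum (removeAt B i) t λ j → h (punchIn i j) (punchInᵢ≢i i j)))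

-- Unique extensions in an arbitrary graph

module _ {G : Graph} {k : ℕ} where

  neighbours-force : ∀ {c : Colouring G k} {v x} → Proper G k c →
                     (∀ a → a ≢ x → ∃[ w ] adj G v w ≡ true × c w ≡ a) → c v ≡ x
  neighbours-force {c} {v} {x} proper sees with c v ≟ x
  ... | yes cv≡x = cv≡x
  ... | no cv≢x  = let (w , vw , cw≡cv) = sees (c v) cv≢x in ⊥-elim (proper v w vw (sym cw≡cv))

  updateAt-proper : ∀ {c : Colouring G k} {v a} → Proper G k c →
                    (∀ w → adj G v w ≡ true → c w ≢ a) → Proper G k (updateAt c v (const a))
  updateAt-proper {c} {v} {a} proper fresh x y xy with x ≟ v | y ≟ v
  ... | yes refl | yes refl = contradiction (trans (sym (irrefl G x)) xy) λ ()
  ... | yes refl | no y≢v   = λ e →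
    fresh y xy (trans (sym (updateAt-minimal y v c y≢v)) (trans (sym e) (updateAt-updates v c)))
  ... | no x≢v   | yes refl = λ e → fresh x (trans (Graph.sym G v x) xy)
    (trans (sym (updateAt-minimal x v c x≢v)) (trans e (updateAt-updates v c)))
  ... | no x≢v   | no y≢v   = λ e →
    proper x y xy (trans (sym (updateAt-minimal x v c x≢v)) (trans e (updateAt-minimal y v c y≢v)))

  updateAt-extends : ∀ {p : PartialColouring G k} {c v a} → Extends G k p c → p v ≡ nothing →
                     Extends G k p (updateAt c v (const a))
  updateAt-extends {c = c} {v} extends free w x pw with w ≟ v
  ... | yes refl = contradiction (trans (sym free) pw) λ ()
  ... | no w≢v   = trans (updateAt-minimal w v c w≢v) (extends w x pw)

  uncoloured-sees-all : ∀ {p : PartialColouring G k} ((c , _) : UniqueExtension G k p) {v a} →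
                        p v ≡ nothing → a ≢ c v → ∃[ w ] adj G v w ≡ true × c w ≡ a
  uncoloured-sees-all (c , proper , extends , unique) {v} {a} free a≢cv
    with any? (λ w → (adj G v w ≟ᵇ true) ×-dec (c w ≟ a))
  ... | yes seen = seen
  ... | no unseen = contradiction (trans (sym (updateAt-updates v c)) (unique _ proper′ extends′ v)) a≢cv
    where
    proper′ : Proper G k (updateAt c v (const a))
    proper′ = updateAt-proper proper λ w vw cw≡a → unseen (w , vw , cw≡a)

    extends′ : Extends G k _ (updateAt c v (const a))
    extends′ = updateAt-extends {c = c} extends free

-- The blown-up crown graph

module Crown (r t : ℕ) where

  -- (i , zero) is the hub of block i and (i , suc s) its s-th leaf.
  Position : Set
  Position = Fin r × Fin (suc t)

  -- The hub's block comes first in both clauses, so symmetry holds by computation.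
  Adjacentᵇ : Position → Position → Bool
  Adjacentᵇ (i , zero)  (j , suc _) = not (i == j)
  Adjacentᵇ (i , suc _) (j , zero)  = not (j == i)
  Adjacentᵇ (_ , zero)  (_ , zero)  = false
  Adjacentᵇ (_ , suc _) (_ , suc _) = false

  Adjacentᵇ-sym : ∀ x y → Adjacentᵇ x y ≡ Adjacentᵇ y x
  Adjacentᵇ-sym (_ , zero)  (_ , zero)  = refl
  Adjacentᵇ-sym (_ , zero)  (_ , suc _) = refl
  Adjacentᵇ-sym (_ , suc _) (_ , zero)  = refl
  Adjacentᵇ-sym (_ , suc _) (_ , suc _) = refl

  Adjacentᵇ-irrefl : ∀ x → Adjacentᵇ x x ≡ false
  Adjacentᵇ-irrefl (_ , zero)  = refl
  Adjacentᵇ-irrefl (_ , suc _) = refl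

  position : Fin (r * suc t) → Position
  position = remQuot (suc t)

  crown : Graph
  crown = record
    { n      = r * suc t
    ; adj    = λ v w → Adjacentᵇ (position v) (position w)
    ; sym    = λ v w → Adjacentᵇ-sym (position v) (position w)
    ; irrefl = Adjacentᵇ-irrefl ∘ position
    }

  hub : Fin r → Fin (r * suc t)
  hub i = combine i zero

  leaf : Fin r → Fin t → Fin (r * suc t)
  leaf i s = combine i (suc s)

  data View : Fin (r * suc t) → Set where
    hubᵛ  : ∀ i → View (hub i)
    leafᵛ : ∀ i s → View (leaf i s)

  view : ∀ v → View v
  view v = subst View (combine-remQuot {r} (suc t) v) (viewPosition (position v))
    where
    viewPosition : ∀ x → View (uncurry combine x)
    viewPosition (i , zero)  = hubᵛ i
    viewPosition (i , suc s) = leafᵛ i s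

  adj-combine : ∀ i a j b → adj crown (combine i a) (combine j b) ≡ Adjacentᵇ (i , a) (j , b)
  adj-combine i a j b = cong₂ Adjacentᵇ (remQuot-combine i a) (remQuot-combine j b)

  hub-leaf-adj : ∀ {i j} s → i ≢ j → adj crown (hub i) (leaf j s) ≡ true
  hub-leaf-adj {i} {j} s i≢j = trans (adj-combine i zero j (suc s)) (≢⇒not-== i≢j)

  leaf-hub-adj : ∀ {i j} s → i ≢ j → adj crown (leaf j s) (hub i) ≡ true
  leaf-hub-adj {i} {j} s i≢j = trans (adj-combine j (suc s) i zero) (≢⇒not-== i≢j)

  leaf-neighbour : ∀ j s w → adj crown (leaf j s) w ≡ true → ∃[ l ] l ≢ j × w ≡ hub l
  leaf-neighbour j s w jw with view w
  ... | hubᵛ l    = l , not-==⇒≢ (trans (sym (adj-combine j (suc s) l zero)) jw) , refl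
  ... | leafᵛ l u = contradiction (trans (sym (adj-combine j (suc s) l (suc u))) jw) λ ()

  hub-neighbour : ∀ i w → adj crown (hub i) w ≡ true → ∃[ l ] ∃[ s ] l ≢ i × w ≡ leaf l s
  hub-neighbour i w iw with view w
  ... | leafᵛ l s = l , s , ≢-sym (not-==⇒≢ (trans (sym (adj-combine i zero l (suc s))) iw)) , refl
  ... | hubᵛ l    = contradiction (trans (sym (adj-combine i zero l zero)) iw) λ ()

  onPositions : {A : Set} → (Position → A) → Fin (r * suc t) → A
  onPositions F = F ∘ position

  onPositions-combine : ∀ {A : Set} (F : Position → A) i a → onPositions F (combine i a) ≡ F (i , a)
  onPositions-combine F i a = cong F (remQuot-combine i a)

  onPositions-≡ : ∀ {A : Set} (F : Position → A) i a j b →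
                  onPositions F (combine i a) ≡ onPositions F (combine j b) → F (i , a) ≡ F (j , b)
  onPositions-≡ F i a j b e =
    trans (sym (onPositions-combine F i a)) (trans e (onPositions-combine F j b))

  onPositions-proper : ∀ {k} (F : Position → Fin k) →
                       (∀ {i j} s → i ≢ j → F (i , zero) ≢ F (j , suc s)) → Proper crown k (onPositions F)
  onPositions-proper F differ u v uv with view u
  ... | hubᵛ i with hub-neighbour i v uv
  ...   | l , s , l≢i , refl = differ s (≢-sym l≢i) ∘ onPositions-≡ F i zero l (suc s)
  onPositions-proper F differ u v uv | leafᵛ j s with leaf-neighbour j s v uv
  ...   | l , l≢j , refl = differ s l≢j ∘ sym ∘ onPositions-≡ F j (suc s) l zero

  module DefiningSet {k : ℕ} {p : PartialColouring crown k} (u : UniqueExtension crown k p) where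

    colouring : Colouring crown k
    colouring = proj₁ u

    proper : Proper crown k colouring
    proper = proj₁ (proj₂ u)

    extends : Extends crown k p colouring
    extends = proj₁ (proj₂ (proj₂ u))

    unique : ∀ c → Proper crown k c → Extends crown k p c → ∀ v → c v ≡ colouring v
    unique = proj₂ (proj₂ (proj₂ u))

    hubColours : Fin r → Fin k
    hubColours = colouring ∘ hub

    leaf-uncoloured⇒allButOne : ∀ {j s} → p (leaf j s) ≡ nothing → AllButOne hubColours j
    leaf-uncoloured⇒allButOne {j} {s} free = colouring (leaf j s) , misses , covers
      where
      misses : Misses hubColours j (colouring (leaf j s))
      misses i i≢j = proper (hub i) (leaf j s) (hub-leaf-adj s i≢j)
      covers : ∀ a → a ≢ colouring (leaf j s) → ∃[ l ] l ≢ j × hubColours l ≡ a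
      covers a a≢x with uncoloured-sees-all {crown} u free a≢x
      ... | w , jw , cw≡a with leaf-neighbour j s w jw
      ...   | l , l≢j , refl = l , l≢j , cw≡a

    hub-uncoloured⇒forced : ∀ {i} → p (hub i) ≡ nothing → Forced hubColours i
    hub-uncoloured⇒forced {i} free x x≢ci with uncoloured-sees-all {crown} u free x≢ci
    ... | w , iw , cw≡x with hub-neighbour i w iw
    ...   | l , s , l≢i , refl =
      l , l≢i , λ m m≢l cm≡x → proper (hub m) (leaf l s) (hub-leaf-adj s m≢l) (trans cm≡x (sym cw≡x))

    swap-impossible : Injective _≡_ _≡_ hubColours → ∀ {a b} → a ≢ b →
                      p (hub a) ≡ nothing → (∀ s → p (leaf b s) ≡ nothing) → ⊥
    swap-impossible injective {a} {b} a≢b hub-free leaves-free =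
      a≢b (injective (trans (sym (unique swapped proper′ extends′ (hub a))) swapped-hub))
      where
      swap : Position → Fin k
      swap (i , zero) with i ≟ a
      ... | yes _ = hubColours b
      ... | no _  = hubColours i
      swap (i , suc s) with i ≟ b
      ... | yes _ = hubColours a
      ... | no _  = colouring (leaf i s)

      swapped : Colouring crown k
      swapped = onPositions swap

      swapped-hub : swapped (hub a) ≡ hubColours b
      swapped-hub rewrite remQuot-combine {r} {suc t} a zero with a ≟ a
      ... | yes _  = refl
      ... | no a≢a = contradiction refl a≢a

      differ : ∀ {i j} s → i ≢ j → swap (i , zero) ≢ swap (j , suc s)
      differ {i} {j} s i≢j with i ≟ a | j ≟ b
      ... | yes refl | yes refl = a≢b ∘ injective ∘ sym
      ... | yes refl | no j≢b   = proper (hub b) (leaf j s) (hub-leaf-adj s (≢-sym j≢b))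
      ... | no i≢a   | yes refl = i≢a ∘ injective
      ... | no _     | no _     = proper (hub i) (leaf j s) (hub-leaf-adj s i≢j)

      proper′ : Proper crown k swapped
      proper′ = onPositions-proper swap differ

      extends′ : Extends crown k p swapped
      extends′ v x pv with view v
      ... | hubᵛ i rewrite remQuot-combine {r} {suc t} i zero with i ≟ a
      ...   | yes refl = contradiction (trans (sym hub-free) pv) λ ()
      ...   | no _     = extends (hub i) x pv
      extends′ v x pv | leafᵛ i s rewrite remQuot-combine {r} {suc t} i (suc s) with i ≟ b
      ...   | yes refl = contradiction (trans (sym (leaves-free s)) pv) λ ()
      ...   | no _     = extends (leaf i s) x pv

  bipartite : Bipartite crown
  bipartite = onPositions side , onPositions-proper side λ _ _ ()
    where
    side : Position → Fin 2
    side (_ , zero)  = zero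
    side (_ , suc _) = suc zero

  blockSize : ∀ {k} → PartialColouring crown k → Fin r → ℕ
  blockSize p i = size (p ∘ combine i)

  size-blocks : ∀ {k} (p : PartialColouring crown k) → size p ≡ sum (blockSize p)
  size-blocks p = size-combine r p

  pinning : ∀ {k} (h d : Fin r → Fin k) (pinned : Fin r → Bool) → Position → Maybe (Fin k)
  pinning h d pinned (i , zero)  = just (h i)
  pinning h d pinned (i , suc _) = if pinned i then just (d i) else nothing

  hubsAndLeaves : ∀ {k} (h d : Fin r → Fin k) → Position → Fin k
  hubsAndLeaves h d (i , zero)  = h i
  hubsAndLeaves h d (i , suc _) = d i

  pinning-unique : ∀ {k} (h d : Fin r → Fin k) pinned → (∀ j → Misses h j (d j)) →
                   (∀ j → pinned j ≡ false → ∀ a → a ≢ d j → ∃[ l ] l ≢ j × h l ≡ a) →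
                   UniqueExtension crown k (onPositions (pinning h d pinned))
  pinning-unique {k} h d pinned misses covers = onPositions colour , proper , extends , unique
    where
    colour : Position → Fin k
    colour = hubsAndLeaves h d

    proper : Proper crown k (onPositions colour)
    proper = onPositions-proper colour λ {i} {j} _ i≢j → misses j i i≢j

    extendsAt : ∀ x c → pinning h d pinned x ≡ just c → colour x ≡ c
    extendsAt (i , zero)  c refl = refl
    extendsAt (i , suc _) c e with pinned i
    ... | true = just-injective e

    extends : Extends crown k (onPositions (pinning h d pinned)) (onPositions colour)
    extends v = extendsAt (position v)

    pinned-at : ∀ i a {c} → pinning h d pinned (i , a) ≡ just c →
                onPositions (pinning h d pinned) (combine i a) ≡ just c
    pinned-at i a = trans (onPositions-combine (pinning h d pinned) i a)

    unique : ∀ c → Proper crown k c → Extends crown k (onPositions (pinning h d pinned)) c →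
             ∀ v → c v ≡ onPositions colour v
    unique c proper′ extends′ v with view v
    ... | hubᵛ i    =
      trans (extends′ (hub i) (h i) (pinned-at i zero refl)) (sym (onPositions-combine colour i zero))
    ... | leafᵛ j s = trans leaf-colour (sym (onPositions-combine colour j (suc s)))
      where
      leaf-colour : c (leaf j s) ≡ d j
      leaf-colour with pinned j in eq
      ... | true  =
        extends′ (leaf j s) (d j) (pinned-at j (suc s) (cong (if_then just (d j) else nothing) eq))
      ... | false = neighbours-force {crown} proper′ λ a a≢dj →
        let (l , l≢j , hl≡a) = covers j eq a a≢dj
        in hub l , leaf-hub-adj s l≢j , trans (extends′ (hub l) (h l) (pinned-at l zero refl)) hl≡a

-- sn(G,5) = 5 and sn(G,4) = 10

open Crown 5 5

sn₅-witness : HasDefiningSetOfSize crown 5 5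
sn₅-witness = onPositions (pinning id id (const false)) , refl ,
  pinning-unique id id (const false) (λ _ _ i≢j → i≢j) λ _ _ a a≢j → a , a≢j , refl

sn₅-lower : ∀ m → HasDefiningSetOfSize crown 5 m → 5 ≤ m
sn₅-lower _ (p , refl , u) = ≮⇒≥ (few⇒⊥ ∘ ≤-pred ∘ subst (_< 5) (size-blocks p))
  where
  open DefiningSet u
  B : Fin 5 → ℕ
  B = blockSize p

  few⇒⊥ : sum B ≤ 4 → ⊥
  few⇒⊥ total≤4 = impossible
    where
    exceeds : ∀ {L} → ¬ L ≤ 4 → L ≤ sum B → ⊥
    exceeds L≰4 L≤sum = L≰4 (≤-trans L≤sum total≤4)

    injective : Injective _≡_ _≡_ hubColours
    injective = allButOne-everywhere⇒injective hubColours λ j → leaf-uncoloured⇒allButOne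
      (proj₂ (size<-tail-uncoloured (p ∘ combine j) (s≤s (≤-trans (≤-sum B j) total≤4))))

    impossible : ⊥
    impossible with any? (λ i → B i ≟ℕ 0)
    ... | no nonempty = exceeds (from-no (5 ≤? 4)) (*-≤-sum B 1 λ i → n≢0⇒n>0 (nonempty ∘ (i ,_)))
    ... | yes (i₀ , empty) with any? (λ j → ¬? (j ≟ i₀) ×-dec (B j ≤? 1))
    ...   | no big = exceeds (from-no (8 ≤? 4))
      (≤-trans (m≤n+m 8 (B i₀)) (+*-≤-sum B i₀ 2 λ j j≢i₀ → ≰⇒> (big ∘ (j ,_) ∘ (j≢i₀ ,_))))
    ...   | yes (j , j≢i₀ , tiny) with size≤1⇒head-or-tail-uncoloured (p ∘ combine j) tiny
    ...     | inj₁ hub-free    =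
      swap-impossible injective j≢i₀ hub-free (size≡0⇒uncoloured (p ∘ combine i₀) empty ∘ suc)
    ...     | inj₂ leaves-free =
      swap-impossible injective (≢-sym j≢i₀) (size≡0⇒uncoloured (p ∘ combine i₀) empty zero) leaves-free

sn₅ : IsSn crown 5 5
sn₅ = sn₅-witness , sn₅-lower

pairedHubs : Fin 5 → Fin 4
pairedHubs = 0F ∷ 0F ∷ 1F ∷ 1F ∷ 2F ∷ []

pairedHubs-misses-3 : ∀ j → Misses pairedHubs j 3F
pairedHubs-misses-3 _ 0F _ ()
pairedHubs-misses-3 _ 1F _ ()
pairedHubs-misses-3 _ 2F _ ()
pairedHubs-misses-3 _ 3F _ ()
pairedHubs-misses-3 _ 4F _ ()

pairedHubs-cover : ∀ j → (j == 4F) ≡ false → ∀ a → a ≢ 3F → ∃[ l ] l ≢ j × pairedHubs l ≡ a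
pairedHubs-cover 0F _ 0F _ = 1F , (λ ()) , refl
pairedHubs-cover 1F _ 0F _ = 0F , (λ ()) , refl
pairedHubs-cover 2F _ 0F _ = 0F , (λ ()) , refl
pairedHubs-cover 3F _ 0F _ = 0F , (λ ()) , refl
pairedHubs-cover 0F _ 1F _ = 2F , (λ ()) , refl
pairedHubs-cover 1F _ 1F _ = 2F , (λ ()) , refl
pairedHubs-cover 2F _ 1F _ = 3F , (λ ()) , refl
pairedHubs-cover 3F _ 1F _ = 2F , (λ ()) , refl
pairedHubs-cover 0F _ 2F _ = 4F , (λ ()) , refl
pairedHubs-cover 1F _ 2F _ = 4F , (λ ()) , refl
pairedHubs-cover 2F _ 2F _ = 4F , (λ ()) , refl
pairedHubs-cover 3F _ 2F _ = 4F , (λ ()) , refl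
pairedHubs-cover 4F () _ _
pairedHubs-cover _  _ 3F a≢3 = contradiction refl a≢3

sn₄-witness : HasDefiningSetOfSize crown 4 10
sn₄-witness = onPositions (pinning pairedHubs (const 3F) (_== 4F)) , refl ,
  pinning-unique pairedHubs (const 3F) (_== 4F) pairedHubs-misses-3 pairedHubs-cover

sn₄-lower : ∀ m → HasDefiningSetOfSize crown 4 m → 10 ≤ m
sn₄-lower _ (p , refl , u) = ≮⇒≥ (few⇒⊥ ∘ ≤-pred ∘ subst (_< 10) (size-blocks p))
  where
  open DefiningSet u
  B : Fin 5 → ℕ
  B = blockSize p

  LeavesColoured : Fin 5 → Set
  LeavesColoured i = ∀ s → p (leaf i s) ≢ nothing

  leavesColoured? : ∀ i → Dec (LeavesColoured i)
  leavesColoured? i = all? λ s → ¬? (≡-decᵐ _≟_ (p (leaf i s)) nothing)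

  uncoloured-leaf⇒allButOne : ∀ i → ¬ LeavesColoured i → AllButOne hubColours i
  uncoloured-leaf⇒allButOne i not-all with any? (λ s → ≡-decᵐ _≟_ (p (leaf i s)) nothing)
  ... | yes (_ , free) = leaf-uncoloured⇒allButOne free
  ... | no none        = contradiction (λ s free → none (s , free)) not-all

  few⇒⊥ : sum B ≤ 9 → ⊥
  few⇒⊥ total≤9 = impossible
    where
    exceeds : ∀ {L} → ¬ L ≤ 9 → L ≤ sum B → ⊥
    exceeds L≰9 L≤sum = L≰9 (≤-trans L≤sum total≤9)

    impossible : ⊥
    impossible with any? leavesColoured?
    ... | no none = ¬allButOne-everywhere hubColours λ i → uncoloured-leaf⇒allButOne i (none ∘ (i ,_))
    ... | yes (j₀ , full₀) with any? (λ i → ¬? (i ≟ j₀) ×-dec leavesColoured? i)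
    ...   | yes (i₁ , i₁≢j₀ , full₁) = exceeds (from-no (10 ≤? 9)) (≤-trans
      (+-mono-≤ (tail-coloured⇒≤size (p ∘ combine j₀) full₀) (tail-coloured⇒≤size (p ∘ combine i₁) full₁))
      (+-≤-sum B (≢-sym i₁≢j₀)))
    ...   | no others = exceeds (from-no (10 ≤? 9)) (≤-trans
      (+-mono-≤ block₀-full (≤-refl {4}))
      (+*-≤-sum B j₀ 1 λ i _ → size-pos (p ∘ combine i) zero (hub-coloured i)))
      where
      hub-coloured : ∀ i → p (hub i) ≢ nothing
      hub-coloured i free = allButOne-off⇒¬forced hubColours j₀
        (λ l l≢j₀ → uncoloured-leaf⇒allButOne l (others ∘ (l ,_) ∘ (l≢j₀ ,_))) i (hub-uncoloured⇒forced free)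

      block₀-full : 6 ≤ B j₀
      block₀-full = ≤-reflexive (sym (size-complete (p ∘ combine j₀)
        λ { zero → hub-coloured j₀ ; (suc s) → full₀ s }))

sn₄ : IsSn crown 4 10
sn₄ = sn₄-witness , sn₄-lower

colours≥2 : ∀ m → Colourable crown m → 2 ≤ m
colours≥2 zero (c , _) with c (hub 0F)
... | ()
colours≥2 (suc zero) (c , proper) with c (hub 0F) in e₀ | c (leaf 1F 0F) in e₁
... | zero | zero = ⊥-elim (proper (hub 0F) (leaf 1F 0F) (hub-leaf-adj {0F} {1F} 0F λ ()) (trans e₀ (sym e₁)))
colours≥2 (suc (suc m)) _ = s≤s (s≤s z≤n)

mainTheorem11 : Σ Graph (λ G → Bipartite G × Σ ℕ (λ k → Σ ℕ (λ χ → Σ ℕ (λ s → Σ ℕ (λ s' → 1 ≤ k × IsChromaticNumber G χ × χ ≤ k ∸ 1 × IsSn G k s × IsSn G (k ∸ 1) s' × s < s')))))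
mainTheorem11 =
  crown , bipartite , 5 , 2 , 5 , 10 ,
  s≤s z≤n , (bipartite , colours≥2) , s≤s (s≤s z≤n) , sn₅ , sn₄ , from-yes (5 <? 10)
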